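{- If $f$ is a monotone polynomial on a finitely presented Heyting algebra $H$, then the greatest fixed point $\nu.f$ exists and $$\nu.f = \exists_{x}.( x \land (x \to f(x))).$$
   Context: For a Heyting algebra $H$, $H[x]$ is the coproduct (in the category of Heyting algebras) of $H$ with the free Heyting algebra on one generator $x$; an element $f \in H[x]$ is evaluated at $h \in H$ via the unique morphism $H[x] \to H$ fixing $H$ and sending $x$ to $h$, and $f$ is monotone if the resulting function $H \to H$ is monotone. When $H$ is finitely presented, the canonical inclusion $i_{x} : H \to H[x]$ has a left adjoint $\exists_{x} : H[x] \to H$ (so $\exists_{x}.f \leq h$ iff $f \leq i_{x}(h)$). Elements of $H$ are identified with constant polynomials. -}

module Defs where

open import Level using (Level; _⊔_)
open import Data.Nat using (ℕ)
open import Data.Fin using (Fin)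
open import Data.Unit using (tt) renaming (⊤ to Unit)
open import Data.Sum using (_⊎_; inj₁; inj₂)
open import Data.Product using (Σ; ∃; _×_; _,_)
open import Data.List using (List)
open import Data.List.Membership.Propositional using (_∈_)
open import Relation.Binary.Lattice.Bundles using (HeytingAlgebra)

private variable a ℓ : Level

data Term (A : Set a) : Set a where
  atom          : A → Term A
  ⊤ᵗ ⊥ᵗ         : Term A
  _∧ᵗ_ _∨ᵗ_ _⇒ᵗ_ : Term A → Term A → Term A

infixr 7 _∧ᵗ_
infixr 6 _∨ᵗ_
infixr 5 _⇒ᵗ_

-- The order of the Heyting algebra freely generated by the atoms A,
-- subject to the extra inequations Ax (the presented algebra).
-- Its setoid quotient (s ≈ t iff s ⊢ t and t ⊢ s) is the presented
-- Heyting algebra; these rules are the Heyting algebra order axioms.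
data Derives {A : Set a} (Ax : Term A → Term A → Set ℓ)
             : Term A → Term A → Set (a ⊔ ℓ) where
  ax     : ∀ {s t} → Ax s t → Derives Ax s t
  refl′  : ∀ {s} → Derives Ax s s
  trans′ : ∀ {s t u} → Derives Ax s t → Derives Ax t u → Derives Ax s u
  ⊤-max  : ∀ {s} → Derives Ax s ⊤ᵗ
  ⊥-min  : ∀ {s} → Derives Ax ⊥ᵗ s
  ∧-l    : ∀ {s t} → Derives Ax (s ∧ᵗ t) s
  ∧-r    : ∀ {s t} → Derives Ax (s ∧ᵗ t) t
  ∧-glb  : ∀ {s t u} → Derives Ax u s → Derives Ax u t → Derives Ax u (s ∧ᵗ t)
  ∨-l    : ∀ {s t} → Derives Ax s (s ∨ᵗ t)
  ∨-r    : ∀ {s t} → Derives Ax t (s ∨ᵗ t)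
  ∨-lub  : ∀ {s t u} → Derives Ax s u → Derives Ax t u → Derives Ax (s ∨ᵗ t) u
  ⇒-intro : ∀ {s t u} → Derives Ax (s ∧ᵗ t) u → Derives Ax s (t ⇒ᵗ u)
  ⇒-elim  : ∀ {s t u} → Derives Ax s (t ⇒ᵗ u) → Derives Ax (s ∧ᵗ t) u

module _ {c ℓ₁ ℓ₂} (H : HeytingAlgebra c ℓ₁ ℓ₂) where
  open HeytingAlgebra H

  ⟦_⟧_ : {A : Set a} → Term A → (A → Carrier) → Carrier
  ⟦ atom v ⟧ ρ = ρ v
  ⟦ ⊤ᵗ ⟧ ρ = ⊤
  ⟦ ⊥ᵗ ⟧ ρ = ⊥
  ⟦ s ∧ᵗ t ⟧ ρ = ⟦ s ⟧ ρ ∧ ⟦ t ⟧ ρ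
  ⟦ s ∨ᵗ t ⟧ ρ = ⟦ s ⟧ ρ ∨ ⟦ t ⟧ ρ
  ⟦ s ⇒ᵗ t ⟧ ρ = ⟦ s ⟧ ρ ⇨ ⟦ t ⟧ ρ

  -- H is finitely presented: H ≅ F(g₁..gₙ)/R for finitely many relations R
  -- (the interpretation of generators gives an isomorphism of the
  -- presented algebra onto H: surjective and order-reflecting/preserving).
  FinitelyPresented : Set (c ⊔ ℓ₁ ⊔ ℓ₂)
  FinitelyPresented =
    Σ ℕ λ n → Σ (List (Term (Fin n) × Term (Fin n))) λ R → Σ (Fin n → Carrier) λ g →
      (∀ h → ∃ λ t → ⟦ t ⟧ g ≈ h) ×
      (∀ s t → (⟦ s ⟧ g ≤ ⟦ t ⟧ g → Derives (λ u v → (u , v) ∈ R) s t)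
             × (Derives (λ u v → (u , v) ∈ R) s t → ⟦ s ⟧ g ≤ ⟦ t ⟧ g))

  -- Polynomials: H[x] = H + F(x), presented by generators H ⊎ {x}
  -- subject to the diagram of H.
  Poly : Set c
  Poly = Term (Carrier ⊎ Unit)

  const : Carrier → Poly
  const h = atom (inj₁ h)

  var : Poly
  var = atom (inj₂ tt)

  data Diagram : Poly → Poly → Set (c ⊔ ℓ₂) where
    d-≤  : ∀ {h k} → h ≤ k → Diagram (const h) (const k)
    d-⊤  : Diagram ⊤ᵗ (const ⊤)
    d-⊥  : Diagram (const ⊥) ⊥ᵗ
    d-∧  : ∀ {h k} → Diagram (const h ∧ᵗ const k) (const (h ∧ k))
    d-∧′ : ∀ {h k} → Diagram (const (h ∧ k)) (const h ∧ᵗ const k)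
    d-∨  : ∀ {h k} → Diagram (const h ∨ᵗ const k) (const (h ∨ k))
    d-∨′ : ∀ {h k} → Diagram (const (h ∨ k)) (const h ∨ᵗ const k)
    d-⇒  : ∀ {h k} → Diagram (const h ⇒ᵗ const k) (const (h ⇨ k))
    d-⇒′ : ∀ {h k} → Diagram (const (h ⇨ k)) (const h ⇒ᵗ const k)

  _≤[x]_ : Poly → Poly → Set (c ⊔ ℓ₂)
  p ≤[x] q = Derives Diagram p q

  iₓ : Carrier → Poly
  iₓ = const

  eval : Poly → Carrier → Carrier
  eval p h = ⟦ p ⟧ λ { (inj₁ k) → k ; (inj₂ _) → h }

  Monotone : Poly → Set (c ⊔ ℓ₂)
  Monotone f = ∀ h k → h ≤ k → eval f h ≤ eval f k

  IsLeftAdjointToIₓ : (Poly → Carrier) → Set (c ⊔ ℓ₂)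
  IsLeftAdjointToIₓ E = ∀ p h → (E p ≤ h → p ≤[x] iₓ h) × (p ≤[x] iₓ h → E p ≤ h)

  IsGreatestFixedPoint : (Carrier → Carrier) → Carrier → Set (c ⊔ ℓ₁ ⊔ ℓ₂)
  IsGreatestFixedPoint φ e = (φ e ≈ e) × (∀ y → φ y ≈ y → y ≤ e)

-- Put P = x ∧ (x → f x). Evaluating P at a post-fixed point y ≤ f y gives
-- y, so the unit P ≤ ∃ₓP of the adjunction bounds every post-fixed point by
-- ∃ₓP. Conversely, under the hypothesis P ∧ ∃ₓP the variable x and the
-- constant ∃ₓP are interderivable, so f may be replaced by the constant
-- f(∃ₓP); hence P ≤ f(∃ₓP) in H[x], and ∃ₓP ≤ f(∃ₓP) by adjunction. Thus
-- ∃ₓP is the greatest post-fixed point, and by monotonicity a fixed point.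
module Submission where

open import Defs
open import Relation.Binary.Lattice.Bundles using (HeytingAlgebra)
open import Data.Unit using (tt)
open import Data.Sum using (inj₁; inj₂)
open import Data.Product using (_,_; _×_; proj₁; proj₂)

module DerivedRules {a ℓ} {A : Set a} {Ax : Term A → Term A → Set ℓ} where

  infix 4 _⊢_ _∣_⊢_

  _⊢_ : Term A → Term A → Set _
  _⊢_ = Derives Ax

  _∣_⊢_ : Term A → Term A → Term A → Set _
  Γ ∣ s ⊢ t = Γ ∧ᵗ s ⊢ t

  ⇒-mp : ∀ {u s t} → u ⊢ s ⇒ᵗ t → u ⊢ s → u ⊢ t
  ⇒-mp p q = trans′ (∧-glb p q) (⇒-elim refl′)

  ∧-swap : ∀ {s t} → s ∧ᵗ t ⊢ t ∧ᵗ s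
  ∧-swap = ∧-glb ∧-r ∧-l

  ∧-distribˡ-∨ : ∀ {u s t} → u ∧ᵗ (s ∨ᵗ t) ⊢ (u ∧ᵗ s) ∨ᵗ (u ∧ᵗ t)
  ∧-distribˡ-∨ = trans′ ∧-swap
    (⇒-elim (∨-lub (⇒-intro (trans′ ∧-swap ∨-l)) (⇒-intro (trans′ ∧-swap ∨-r))))

  hyp-trans : ∀ {Γ s s′ t} → s ⊢ s′ → Γ ∣ s′ ⊢ t → Γ ∣ s ⊢ t
  hyp-trans p q = trans′ (∧-glb ∧-l (trans′ ∧-r p)) q

  ∧-mono-∣ : ∀ {Γ s t s′ t′} → Γ ∣ s ⊢ s′ → Γ ∣ t ⊢ t′ → Γ ∣ s ∧ᵗ t ⊢ s′ ∧ᵗ t′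
  ∧-mono-∣ p q = ∧-glb (hyp-trans ∧-l p) (hyp-trans ∧-r q)

  ∨-mono-∣ : ∀ {Γ s t s′ t′} → Γ ∣ s ⊢ s′ → Γ ∣ t ⊢ t′ → Γ ∣ s ∨ᵗ t ⊢ s′ ∨ᵗ t′
  ∨-mono-∣ p q = trans′ ∧-distribˡ-∨ (∨-lub (trans′ p ∨-l) (trans′ q ∨-r))

  ⇒-mono-∣ : ∀ {Γ s t s′ t′} → Γ ∣ s′ ⊢ s → Γ ∣ t ⊢ t′ → Γ ∣ s ⇒ᵗ t ⊢ s′ ⇒ᵗ t′
  ⇒-mono-∣ {Γ} {s} {t} {s′} p q = ⇒-intro (trans′ (∧-glb ⊢Γ ⊢t) q)
    where
    ⊢Γ : (Γ ∧ᵗ (s ⇒ᵗ t)) ∧ᵗ s′ ⊢ Γ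
    ⊢Γ = trans′ ∧-l ∧-l

    ⊢t : (Γ ∧ᵗ (s ⇒ᵗ t)) ∧ᵗ s′ ⊢ t
    ⊢t = ⇒-mp (trans′ ∧-l ∧-r) (trans′ (∧-glb ⊢Γ ∧-r) p)

module _ {c ℓ₁ ℓ₂} (H : HeytingAlgebra c ℓ₁ ℓ₂) where
  open HeytingAlgebra H
  open DerivedRules {Ax = Diagram H}

  eval-sound : ∀ {p q} h → p ⊢ q → eval H p h ≤ eval H q h
  eval-sound h (ax (d-≤ k≤k′)) = k≤k′
  eval-sound h (ax d-⊤)        = refl
  eval-sound h (ax d-⊥)        = refl
  eval-sound h (ax d-∧)        = refl
  eval-sound h (ax d-∧′)       = refl
  eval-sound h (ax d-∨)        = refl
  eval-sound h (ax d-∨′)       = refl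
  eval-sound h (ax d-⇒)        = refl
  eval-sound h (ax d-⇒′)       = refl
  eval-sound h refl′           = refl
  eval-sound h (trans′ p q)    = trans (eval-sound h p) (eval-sound h q)
  eval-sound h ⊤-max           = maximum _
  eval-sound h ⊥-min           = minimum _
  eval-sound h ∧-l             = x∧y≤x _ _
  eval-sound h ∧-r             = x∧y≤y _ _
  eval-sound h (∧-glb p q)     = ∧-greatest (eval-sound h p) (eval-sound h q)
  eval-sound h ∨-l             = x≤x∨y _ _
  eval-sound h ∨-r             = y≤x∨y _ _
  eval-sound h (∨-lub p q)     = ∨-least (eval-sound h p) (eval-sound h q)
  eval-sound h (⇒-intro p)     = transpose-⇨ (eval-sound h p)
  eval-sound h (⇒-elim p)      = transpose-∧ (eval-sound h p)

  subst-var : ∀ {Γ e} → Γ ∣ var H ⊢ const H e → Γ ∣ const H e ⊢ var H →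
              ∀ t → (Γ ∣ t ⊢ const H (eval H t e)) × (Γ ∣ const H (eval H t e) ⊢ t)
  subst-var x⊢e e⊢x (atom (inj₁ k)) = ∧-r , ∧-r
  subst-var x⊢e e⊢x (atom (inj₂ tt)) = x⊢e , e⊢x
  subst-var x⊢e e⊢x ⊤ᵗ = trans′ ⊤-max (ax d-⊤) , ⊤-max
  subst-var x⊢e e⊢x ⊥ᵗ = trans′ ∧-r ⊥-min , trans′ ∧-r (trans′ (ax d-⊥) ⊥-min)
  subst-var x⊢e e⊢x (s ∧ᵗ t) with subst-var x⊢e e⊢x s | subst-var x⊢e e⊢x t
  ... | s⊢ , ⊢s | t⊢ , ⊢t = trans′ (∧-mono-∣ s⊢ t⊢) (ax d-∧) , hyp-trans (ax d-∧′) (∧-mono-∣ ⊢s ⊢t)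
  subst-var x⊢e e⊢x (s ∨ᵗ t) with subst-var x⊢e e⊢x s | subst-var x⊢e e⊢x t
  ... | s⊢ , ⊢s | t⊢ , ⊢t = trans′ (∨-mono-∣ s⊢ t⊢) (ax d-∨) , hyp-trans (ax d-∨′) (∨-mono-∣ ⊢s ⊢t)
  subst-var x⊢e e⊢x (s ⇒ᵗ t) with subst-var x⊢e e⊢x s | subst-var x⊢e e⊢x t
  ... | s⊢ , ⊢s | t⊢ , ⊢t = trans′ (⇒-mono-∣ ⊢s t⊢) (ax d-⇒) , hyp-trans (ax d-⇒′) (⇒-mono-∣ s⊢ ⊢t)

  module _ (∃ₓ : Poly H → Carrier) (∃ₓ⊣iₓ : IsLeftAdjointToIₓ H ∃ₓ) (f : Poly H) where

    P : Poly H
    P = var H ∧ᵗ (var H ⇒ᵗ f)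

    ν : Carrier
    ν = ∃ₓ P

    P⊢ν : P ⊢ const H ν
    P⊢ν = proj₁ (∃ₓ⊣iₓ P ν) refl

    postfixed⇒≤ν : ∀ y → y ≤ eval H f y → y ≤ ν
    postfixed⇒≤ν y y≤fy =
      trans (∧-greatest refl (transpose-⇨ (trans (x∧y≤y _ _) y≤fy))) (eval-sound y P⊢ν)

    ν≤fν : ν ≤ eval H f ν
    ν≤fν = proj₂ (∃ₓ⊣iₓ P (eval H f ν))
      (trans′ (∧-glb (∧-glb ∧-l P⊢ν) (⇒-mp ∧-r ∧-l)) (proj₁ (subst-var x⊢ν ν⊢x f)))
      where
      x⊢ν : var H ∧ᵗ const H ν ∣ var H ⊢ const H ν
      x⊢ν = trans′ ∧-l ∧-r

      ν⊢x : var H ∧ᵗ const H ν ∣ const H ν ⊢ var H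
      ν⊢x = trans′ ∧-l ∧-l

    ν-greatestFixedPoint : Monotone H f → IsGreatestFixedPoint H (eval H f) ν
    ν-greatestFixedPoint mono =
        antisym (postfixed⇒≤ν (eval H f ν) (mono _ _ ν≤fν)) ν≤fν
      , λ y fy≈y → postfixed⇒≤ν y (reflexive (Eq.sym fy≈y))

-- Finite presentation is only what guarantees that ∃ₓ exists; here ∃ₓ and
-- its adjointness are supplied directly.
proposition4p1 : ∀ {c ℓ₁ ℓ₂} (H : HeytingAlgebra c ℓ₁ ℓ₂) → FinitelyPresented H
    → (∃ₓ : Poly H → HeytingAlgebra.Carrier H) → IsLeftAdjointToIₓ H ∃ₓ
    → (f : Poly H) → Monotone H f
    → IsGreatestFixedPoint H (eval H f) (∃ₓ (var H ∧ᵗ (var H ⇒ᵗ f)))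
proposition4p1 H _ ∃ₓ ∃ₓ⊣iₓ f mono = ν-greatestFixedPoint H ∃ₓ ∃ₓ⊣iₓ f mono
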